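{- Let $m\ge2$ and let $X$ be the set of all transpositions in $S_m$, a quandle under $x^y=y^{ -1}xy$. Then for every positive integer $n$ and every $s\in X^n$ whose entries generate $X$ (i.e. lie in no proper subset of $X$ closed under the operation), the restriction to the stabilizer of $s$ in $B_n$ of the homomorphism $B_n\to S_n$ is surjective.
   Context: $B_n$ acts on $X^n$ on the right by $(\dots,c_i,c_{i+1},\dots)^{\sigma_i}=(\dots,c_{i+1},c_{i+1}^{ -1}c_ic_{i+1},\dots)$, and $B_n\to S_n$ sends $\sigma_i\mapsto(i\ i+1)$. -}

module Defs where

open import Data.Nat using (ℕ; zero; suc)
open import Data.Fin using (Fin; zero; suc; inject₁; _<_)
open import Data.Fin.Properties using (<-cmp)
open import Data.Fin.Permutation using (Permutation′; transpose; _⟨$⟩ʳ_; _⟨$⟩ˡ_; inverseˡ; id; _∘ₚ_)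
open import Data.Product using (Σ; _×_; _,_; proj₁; proj₂)
open import Data.Vec using (Vec; []; _∷_; lookup)
open import Data.List using (List; []; _∷_)
open import Data.Empty using (⊥-elim)
open import Relation.Binary using (tri<; tri≈; tri>)
open import Relation.Binary.PropositionalEquality using (_≡_; _≢_; refl; cong; sym; trans)

-- A transposition (a b) of S_m, represented by its support {a, b}
-- written in increasing order a < b (so distinct transpositions are
-- distinct elements of this type).
Transp : ℕ → Set
Transp m = Σ (Fin m × Fin m) (λ p → proj₁ p < proj₂ p)

toPerm : ∀ {m} → Transp m → Permutation′ m
toPerm ((a , b) , _) = transpose a b

mkTransp : ∀ {m} (u v : Fin m) → u ≢ v → Transp m
mkTransp u v u≢v with <-cmp u v
... | tri< u<v _ _ = (u , v) , u<v
... | tri≈ _ u≡v _ = ⊥-elim (u≢v u≡v)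
... | tri> _ _ v<u = (v , u) , v<u

private
  <⇒≢ : ∀ {m} {a b : Fin m} → a < b → a ≢ b
  <⇒≢ {a = a} a<b refl = Data.Fin.Properties.<-irrefl refl a<b

  perm-inj : ∀ {m} (π : Permutation′ m) {a b : Fin m} → a ≢ b → π ⟨$⟩ʳ a ≢ π ⟨$⟩ʳ b
  perm-inj π {a} {b} a≢b e =
    a≢b (trans (sym (inverseˡ π)) (trans (cong (π ⟨$⟩ˡ_) e) (inverseˡ π)))

-- The quandle operation x ▷ y = x^y = y⁻¹ x y.  The conjugate of the
-- transposition (a b) by the transposition y is the transposition
-- (y(a) y(b)).
_▷_ : ∀ {m} → Transp m → Transp m → Transp m
((a , b) , a<b) ▷ y =
  mkTransp (toPerm y ⟨$⟩ʳ a) (toPerm y ⟨$⟩ʳ b) (perm-inj (toPerm y) (<⇒≢ a<b))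

-- The inverse operation x^{y⁻¹} = y x y⁻¹ ; for transpositions y⁻¹ = y.
_▷⁻¹_ : ∀ {m} → Transp m → Transp m → Transp m
x ▷⁻¹ y = x ▷ y

-- Braid words in B_{k+1}: generators σ_i (i : Fin k) and their inverses.
data Letter (k : ℕ) : Set where
  σ   : Fin k → Letter k
  σ⁻¹ : Fin k → Letter k

BraidWord : ℕ → Set
BraidWord k = List (Letter k)

actσ : ∀ {A : Set} {k} → (A → A → A) → Vec A (suc k) → Fin k → Vec A (suc k)
actσ _∙_ (c ∷ d ∷ cs) zero    = d ∷ (c ∙ d) ∷ cs
actσ _∙_ (c ∷ cs)     (suc i) = c ∷ actσ _∙_ cs i

actσ⁻¹ : ∀ {A : Set} {k} → (A → A → A) → Vec A (suc k) → Fin k → Vec A (suc k)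
actσ⁻¹ _∙_ (c ∷ d ∷ cs) zero    = (d ∙ c) ∷ c ∷ cs
actσ⁻¹ _∙_ (c ∷ cs)     (suc i) = c ∷ actσ⁻¹ _∙_ cs i

actLetter : ∀ {m k} → Vec (Transp m) (suc k) → Letter k → Vec (Transp m) (suc k)
actLetter s (σ i)   = actσ _▷_ s i
actLetter s (σ⁻¹ i) = actσ⁻¹ _▷⁻¹_ s i

act : ∀ {m k} → Vec (Transp m) (suc k) → BraidWord k → Vec (Transp m) (suc k)
act s []      = s
act s (l ∷ w) = act (actLetter s l) w

letterPerm : ∀ {k} → Letter k → Permutation′ (suc k)
letterPerm (σ i)   = transpose (inject₁ i) (suc i)
letterPerm (σ⁻¹ i) = transpose (inject₁ i) (suc i)

toSym : ∀ {k} → BraidWord k → Permutation′ (suc k)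
toSym []      = id
toSym (l ∷ w) = letterPerm l ∘ₚ toSym w

Generates : ∀ {m n} → Vec (Transp m) n → Set₁
Generates {m} {n} s =
  (P : Transp m → Set) →
  (∀ x y → P x → P y → P (x ▷ y)) →
  (∀ (i : Fin n) → P (lookup s i)) →
  ∀ x → P x

{-# OPTIONS --safe #-}

-- Call positions i, j of s linked when the transposition (i j) is the image of a braid
-- fixing s.  Linking is an equivalence relation, because (a c) = (a b)(b c)(a b).
-- Adjacent positions whose entries x, y share a point are linked: σ fixes (x, x), and
-- σ³ fixes (x, y) when x ≠ y, by the braid relation y ▷ (x ▷ y) = x of the quandle.
-- Conjugating by σ_t slides an entry from position t+1 to t and turns (i t) into
-- (i t+1), so any two positions whose entries share a point are linked.  Finally, the
-- transpositions whose two points both or neither lie in an entry linked to the first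
-- position form a subquandle containing every entry; since s generates X, every point
-- lies in such an entry, so all positions are linked and all of S_n is reached.
module Submission where

open import Data.Nat using (ℕ; suc; _≤_)
open import Data.Fin using (Fin; zero; suc; inject₁; _≟_)
import Data.Fin as Fin
open import Data.Fin.Properties using (≤-total; <-cmp; <-asym; <-irrefl; <-irrelevant; <⇒≢)
open import Data.Fin.Induction using (<-weakInduction-startingFrom)
import Data.Fin.Permutation.Components as PC
open import Data.Fin.Permutation
  using (Permutation′; transpose; flip; _⟨$⟩ʳ_; _⟨$⟩ˡ_; inverseˡ; inverseʳ; id; _∘ₚ_; _≈_)
open import Data.Fin.Permutation.Transposition.List
  using (TranspositionList; eval; decompose; eval-decompose)
open import Data.List using (_∷_; []; _++_)
open import Data.Vec using (Vec; []; _∷_; lookup)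
open import Data.Product using (Σ; Σ-syntax; _×_; _,_; proj₁)
import Data.Product as Product
open import Data.Sum using (_⊎_; inj₁; inj₂)
import Data.Sum as Sum
open import Data.Empty using (⊥-elim)
open import Function.Base using (_∘_)
open import Function.Bundles using (_⇔_; mk⇔; Equivalence)
open import Relation.Binary using (tri<; tri≈; tri>)
open import Relation.Binary.PropositionalEquality
open import Relation.Nullary using (Dec; yes; no)
open import Relation.Nullary.Decidable using (dec-true; dec-false)

open import Defs

private
  variable
    n : ℕ

transpose-applyˡ : (i j : Fin n) → transpose i j ⟨$⟩ʳ i ≡ j
transpose-applyˡ i j rewrite dec-true (i ≟ i) refl = refl

transpose-applyʳ : (i j : Fin n) → transpose i j ⟨$⟩ʳ j ≡ i
transpose-applyʳ i j with j ≟ i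
... | yes j≡i = j≡i
... | no _ rewrite dec-true (j ≟ j) refl = refl

transpose-fix : (i j : Fin n) {k : Fin n} → k ≢ i → k ≢ j → transpose i j ⟨$⟩ʳ k ≡ k
transpose-fix i j {k} k≢i k≢j rewrite dec-false (k ≟ i) k≢i | dec-false (k ≟ j) k≢j = refl

transpose-comm : (i j : Fin n) → transpose i j ≈ transpose j i
transpose-comm i j k = cases (k ≟ i) (k ≟ j)
  where
  cases : Dec (k ≡ i) → Dec (k ≡ j) → transpose i j ⟨$⟩ʳ k ≡ transpose j i ⟨$⟩ʳ k
  cases (yes refl) (yes refl) = refl
  cases (yes refl) (no _)     = trans (transpose-applyˡ k j) (sym (transpose-applyʳ j k))
  cases (no _)     (yes refl) = trans (transpose-applyʳ i k) (sym (transpose-applyˡ k i))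
  cases (no k≢i)   (no k≢j)   = trans (transpose-fix i j k≢i k≢j) (sym (transpose-fix j i k≢j k≢i))

transpose-involutive : (i j : Fin n) → transpose i j ∘ₚ transpose i j ≈ id
transpose-involutive i j k =
  trans (cong (transpose i j ⟨$⟩ʳ_) (transpose-comm i j k)) (PC.transpose-inverse i j)

transpose-refl : (i : Fin n) → transpose i i ≈ id
transpose-refl i k = cases (k ≟ i)
  where
  cases : Dec (k ≡ i) → transpose i i ⟨$⟩ʳ k ≡ k
  cases (yes refl) = transpose-applyˡ k k
  cases (no k≢i)   = transpose-fix i i k≢i k≢i

conjugate-transpose : (ρ : Permutation′ n) (a b : Fin n) →
  flip ρ ∘ₚ transpose a b ∘ₚ ρ ≈ transpose (ρ ⟨$⟩ʳ a) (ρ ⟨$⟩ʳ b)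
conjugate-transpose ρ a b x = cases (x ≟ ρ ⟨$⟩ʳ a) (x ≟ ρ ⟨$⟩ʳ b)
  where
  open ≡-Reasoning
  ρa = ρ ⟨$⟩ʳ a
  ρb = ρ ⟨$⟩ʳ b
  cases : Dec (x ≡ ρa) → Dec (x ≡ ρb) →
    ρ ⟨$⟩ʳ (transpose a b ⟨$⟩ʳ (ρ ⟨$⟩ˡ x)) ≡ transpose ρa ρb ⟨$⟩ʳ x
  cases (yes refl) _ = begin
    ρ ⟨$⟩ʳ (transpose a b ⟨$⟩ʳ (ρ ⟨$⟩ˡ ρa)) ≡⟨ cong (λ y → ρ ⟨$⟩ʳ (transpose a b ⟨$⟩ʳ y)) (inverseˡ ρ) ⟩
    ρ ⟨$⟩ʳ (transpose a b ⟨$⟩ʳ a)          ≡⟨ cong (ρ ⟨$⟩ʳ_) (transpose-applyˡ a b) ⟩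
    ρb                                      ≡⟨ transpose-applyˡ ρa ρb ⟨
    transpose ρa ρb ⟨$⟩ʳ ρa                 ∎
  cases (no _) (yes refl) = begin
    ρ ⟨$⟩ʳ (transpose a b ⟨$⟩ʳ (ρ ⟨$⟩ˡ ρb)) ≡⟨ cong (λ y → ρ ⟨$⟩ʳ (transpose a b ⟨$⟩ʳ y)) (inverseˡ ρ) ⟩
    ρ ⟨$⟩ʳ (transpose a b ⟨$⟩ʳ b)          ≡⟨ cong (ρ ⟨$⟩ʳ_) (transpose-applyʳ a b) ⟩
    ρa                                      ≡⟨ transpose-applyʳ ρa ρb ⟨
    transpose ρa ρb ⟨$⟩ʳ ρb                 ∎
  cases (no x≢ρa) (no x≢ρb) = begin
    ρ ⟨$⟩ʳ (transpose a b ⟨$⟩ʳ (ρ ⟨$⟩ˡ x)) ≡⟨ cong (ρ ⟨$⟩ʳ_) (transpose-fix a b (unmoved x≢ρa) (unmoved x≢ρb)) ⟩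
    ρ ⟨$⟩ʳ (ρ ⟨$⟩ˡ x)                     ≡⟨ inverseʳ ρ ⟩
    x                                     ≡⟨ transpose-fix ρa ρb x≢ρa x≢ρb ⟨
    transpose ρa ρb ⟨$⟩ʳ x                ∎
    where
    unmoved : ∀ {c} → x ≢ ρ ⟨$⟩ʳ c → ρ ⟨$⟩ˡ x ≢ c
    unmoved x≢ρc ρ⁻¹x≡c = x≢ρc (trans (sym (inverseʳ ρ)) (cong (ρ ⟨$⟩ʳ_) ρ⁻¹x≡c))

transpose-conjugate : {a b c : Fin n} → c ≢ a → c ≢ b →
  transpose b a ∘ₚ transpose c b ∘ₚ transpose b a ≈ transpose c a
transpose-conjugate {a = a} {b} {c} c≢a c≢b x = begin
  τ ⟨$⟩ʳ (transpose c b ⟨$⟩ʳ (τ ⟨$⟩ʳ x))        ≡⟨ cong (λ y → τ ⟨$⟩ʳ (transpose c b ⟨$⟩ʳ y)) (transpose-comm b a x) ⟩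
  (flip τ ∘ₚ transpose c b ∘ₚ τ) ⟨$⟩ʳ x        ≡⟨ conjugate-transpose τ c b x ⟩
  transpose (τ ⟨$⟩ʳ c) (τ ⟨$⟩ʳ b) ⟨$⟩ʳ x       ≡⟨ cong₂ (λ u v → transpose u v ⟨$⟩ʳ x) (transpose-fix b a c≢b c≢a) (transpose-applyˡ b a) ⟩
  transpose c a ⟨$⟩ʳ x ∎
  where
  open ≡-Reasoning
  τ = transpose b a

module _ {m : ℕ} where

  infix 4 _∈ₜ_

  _∈ₜ_ : Fin m → Transp m → Set
  z ∈ₜ ((a , b) , _) = z ≡ a ⊎ z ≡ b

  Meets : Transp m → Transp m → Set
  Meets x y = Σ[ z ∈ Fin m ] z ∈ₜ x × z ∈ₜ y

  ∈ₜ-mkTransp : {u v z : Fin m} (u≢v : u ≢ v) → z ∈ₜ mkTransp u v u≢v ⇔ (z ≡ u ⊎ z ≡ v)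
  ∈ₜ-mkTransp {u} {v} u≢v with <-cmp u v
  ... | tri< _ _ _   = mk⇔ (λ p → p) (λ p → p)
  ... | tri≈ _ u≡v _ = ⊥-elim (u≢v u≡v)
  ... | tri> _ _ _   = mk⇔ Sum.swap Sum.swap

  toPerm-support : {u v : Fin m} (y : Transp m) → u ≢ v → u ∈ₜ y → v ∈ₜ y → toPerm y ≈ transpose u v
  toPerm-support y u≢v (inj₁ refl) (inj₁ refl) = ⊥-elim (u≢v refl)
  toPerm-support y u≢v (inj₁ refl) (inj₂ refl) = λ _ → refl
  toPerm-support y u≢v (inj₂ refl) (inj₁ refl) = transpose-comm _ _
  toPerm-support y u≢v (inj₂ refl) (inj₂ refl) = ⊥-elim (u≢v refl)

  Transp-≡ : {x y : Transp m} → proj₁ x ≡ proj₁ y → x ≡ y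
  Transp-≡ {_ , a<b} {_ , a<b′} refl = cong (_ ,_) (<-irrelevant a<b a<b′)

  support-ordered : {u v : Fin m} (x : Transp m) → u Fin.< v → u ∈ₜ x → v ∈ₜ x → proj₁ x ≡ (u , v)
  support-ordered x u<v (inj₁ refl) (inj₁ refl) = ⊥-elim (<-irrefl refl u<v)
  support-ordered x u<v (inj₁ refl) (inj₂ refl) = refl
  support-ordered (_ , a<b) u<v (inj₂ refl) (inj₁ refl) = ⊥-elim (<-asym a<b u<v)
  support-ordered x u<v (inj₂ refl) (inj₂ refl) = ⊥-elim (<-irrefl refl u<v)

  Transp-ext : {u v : Fin m} {x y : Transp m} → u ≢ v →
    u ∈ₜ x → v ∈ₜ x → u ∈ₜ y → v ∈ₜ y → x ≡ y
  Transp-ext {u} {v} {x} {y} u≢v ux vx uy vy with <-cmp u v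
  ... | tri< u<v _ _ = Transp-≡ (trans (support-ordered x u<v ux vx) (sym (support-ordered y u<v uy vy)))
  ... | tri≈ _ u≡v _ = ⊥-elim (u≢v u≡v)
  ... | tri> _ _ v<u = Transp-≡ (trans (support-ordered x v<u vx ux) (sym (support-ordered y v<u vy uy)))

  ∈ₜ-▷⁺ : {z z′ : Fin m} (x y : Transp m) → z ∈ₜ x → toPerm y ⟨$⟩ʳ z ≡ z′ → z′ ∈ₜ x ▷ y
  ∈ₜ-▷⁺ ((a , b) , _) y z∈x refl =
    Equivalence.from (∈ₜ-mkTransp _) (Sum.map (cong (toPerm y ⟨$⟩ʳ_)) (cong (toPerm y ⟨$⟩ʳ_)) z∈x)

  ∈ₜ-▷⁻ : {z : Fin m} (x y : Transp m) → z ∈ₜ x ▷ y → Σ[ z′ ∈ Fin m ] z′ ∈ₜ x × z ≡ toPerm y ⟨$⟩ʳ z′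
  ∈ₜ-▷⁻ ((a , b) , _) y z∈x▷y with Equivalence.to (∈ₜ-mkTransp _) z∈x▷y
  ... | inj₁ z≡ya = a , inj₁ refl , z≡ya
  ... | inj₂ z≡yb = b , inj₂ refl , z≡yb

  ▷-idem : (x : Transp m) → x ▷ x ≡ x
  ▷-idem x@((a , b) , a<b) = Transp-ext (≢-sym (<⇒≢ a<b))
    (∈ₜ-▷⁺ x x (inj₁ refl) (transpose-applyˡ a b)) (∈ₜ-▷⁺ x x (inj₂ refl) (transpose-applyʳ a b))
    (inj₂ refl) (inj₁ refl)

  ▷-inverse : (x y : Transp m) → (x ▷ y) ▷ y ≡ x
  ▷-inverse x@((a , b) , a<b) y@((c , d) , _) = Transp-ext (<⇒≢ a<b)
    (∈ₜ-▷⁺ (x ▷ y) y (∈ₜ-▷⁺ x y (inj₁ refl) refl) (transpose-involutive c d a))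
    (∈ₜ-▷⁺ (x ▷ y) y (∈ₜ-▷⁺ x y (inj₂ refl) refl) (transpose-involutive c d b))
    (inj₁ refl) (inj₂ refl)

  record MeetOnce (x y : Transp m) : Set where
    field
      z p q : Fin m
      z≢p : z ≢ p
      z≢q : z ≢ q
      p≢q : p ≢ q
      z∈x : z ∈ₜ x
      p∈x : p ∈ₜ x
      z∈y : z ∈ₜ y
      q∈y : q ∈ₜ y

  other-point : {z : Fin m} (x : Transp m) → z ∈ₜ x → Σ[ p ∈ Fin m ] z ≢ p × p ∈ₜ x
  other-point ((a , b) , a<b) (inj₁ refl) = b , <⇒≢ a<b , inj₂ refl
  other-point ((a , b) , a<b) (inj₂ refl) = a , ≢-sym (<⇒≢ a<b) , inj₁ refl

  meets-cases : {x y : Transp m} → Meets x y → x ≡ y ⊎ MeetOnce x y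
  meets-cases {x} {y} (z , z∈x , z∈y) with other-point x z∈x | other-point y z∈y
  ... | p , z≢p , p∈x | q , z≢q , q∈y with p ≟ q
  ... | yes refl = inj₁ (Transp-ext z≢p z∈x p∈x z∈y q∈y)
  ... | no p≢q   = inj₂ (record { z≢p = z≢p ; z≢q = z≢q ; p≢q = p≢q
                                ; z∈x = z∈x ; p∈x = p∈x ; z∈y = z∈y ; q∈y = q∈y })

  module _ {x y : Transp m} (once : MeetOnce x y) where
    open MeetOnce once

    private
      x≈ : toPerm x ≈ transpose z p
      x≈ = toPerm-support x z≢p z∈x p∈x

      y≈ : toPerm y ≈ transpose z q
      y≈ = toPerm-support y z≢q z∈y q∈y

      q∈x▷y : q ∈ₜ x ▷ y
      q∈x▷y = ∈ₜ-▷⁺ x y z∈x (trans (y≈ z) (transpose-applyˡ z q))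

      p∈x▷y : p ∈ₜ x ▷ y
      p∈x▷y = ∈ₜ-▷⁺ x y p∈x (trans (y≈ p) (transpose-fix z q (≢-sym z≢p) p≢q))

      x▷y≈ : toPerm (x ▷ y) ≈ transpose q p
      x▷y≈ = toPerm-support (x ▷ y) (≢-sym p≢q) q∈x▷y p∈x▷y

    ▷-braidˡ : y ▷ (x ▷ y) ≡ x
    ▷-braidˡ = Transp-ext z≢p
      (∈ₜ-▷⁺ y (x ▷ y) z∈y (trans (x▷y≈ z) (transpose-fix q p z≢q z≢p)))
      (∈ₜ-▷⁺ y (x ▷ y) q∈y (trans (x▷y≈ q) (transpose-applyˡ q p)))
      z∈x p∈x

    ▷-braidʳ : (x ▷ y) ▷ x ≡ y
    ▷-braidʳ = Transp-ext z≢q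
      (∈ₜ-▷⁺ (x ▷ y) x p∈x▷y (trans (x≈ p) (transpose-applyʳ z p)))
      (∈ₜ-▷⁺ (x ▷ y) x q∈x▷y (trans (x≈ q) (transpose-fix z p (≢-sym z≢q) (≢-sym p≢q))))
      z∈y q∈y

private
  variable
    k : ℕ

-- actσ (c ∷ v) (suc t) only computes once v is exposed as two conses.
module _ {A : Set} (_∙_ : A → A → A) where

  actσ-cons : (c : A) (v : Vec A (suc k)) (t : Fin k) → actσ _∙_ (c ∷ v) (suc t) ≡ c ∷ actσ _∙_ v t
  actσ-cons c (_ ∷ _ ∷ _) t = refl

  actσ⁻¹-cons : (c : A) (v : Vec A (suc k)) (t : Fin k) → actσ⁻¹ _∙_ (c ∷ v) (suc t) ≡ c ∷ actσ⁻¹ _∙_ v t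
  actσ⁻¹-cons c (_ ∷ _ ∷ _) t = refl

module _ {A : Set} (_∙_ : A → A → A) where

  lookup-actσ-inject₁ : (s : Vec A (suc k)) (t : Fin k) → lookup (actσ _∙_ s t) (inject₁ t) ≡ lookup s (suc t)
  lookup-actσ-inject₁ (_ ∷ _ ∷ _)  zero    = refl
  lookup-actσ-inject₁ (_ ∷ d ∷ cs) (suc t) = lookup-actσ-inject₁ (d ∷ cs) t

  lookup-actσ-other : (s : Vec A (suc k)) (t : Fin k) {i : Fin (suc k)} → i ≢ inject₁ t → i ≢ suc t →
    lookup (actσ _∙_ s t) i ≡ lookup s i
  lookup-actσ-other (_ ∷ _ ∷ _)  zero    {zero}        i≢t _     = ⊥-elim (i≢t refl)
  lookup-actσ-other (_ ∷ _ ∷ _)  zero    {suc zero}    _   i≢t+1 = ⊥-elim (i≢t+1 refl)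
  lookup-actσ-other (_ ∷ _ ∷ _)  zero    {suc (suc _)} _   _     = refl
  lookup-actσ-other (_ ∷ _ ∷ _)  (suc t) {zero}        _   _     = refl
  lookup-actσ-other (_ ∷ d ∷ cs) (suc t) {suc i}       i≢t i≢t+1 =
    lookup-actσ-other (d ∷ cs) t (i≢t ∘ cong suc) (i≢t+1 ∘ cong suc)

  actσ-fixed : (s : Vec A (suc k)) (t : Fin k) →
    lookup s (inject₁ t) ≡ lookup s (suc t) → lookup s (inject₁ t) ∙ lookup s (suc t) ≡ lookup s (suc t) →
    actσ _∙_ s t ≡ s
  actσ-fixed (c ∷ d ∷ cs) zero    c≡d c∙d≡d = cong₂ (λ a b → a ∷ b ∷ cs) (sym c≡d) c∙d≡d
  actσ-fixed (c ∷ d ∷ cs) (suc t) c≡d c∙d≡d = cong (c ∷_) (actσ-fixed (d ∷ cs) t c≡d c∙d≡d)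

  actσ³-fixed : (s : Vec A (suc k)) (t : Fin k) →
    let x = lookup s (inject₁ t) ; y = lookup s (suc t) in
    y ∙ (x ∙ y) ≡ x → (x ∙ y) ∙ (y ∙ (x ∙ y)) ≡ y →
    actσ _∙_ (actσ _∙_ (actσ _∙_ s t) t) t ≡ s
  actσ³-fixed (c ∷ d ∷ cs) zero    e₁ e₂ = cong₂ (λ a b → a ∷ b ∷ cs) e₁ e₂
  actσ³-fixed (c ∷ d ∷ cs) (suc t) e₁ e₂ = begin
    next (next (next (c ∷ d ∷ cs)))                   ≡⟨ cong (next ∘ next) (actσ-cons _∙_ c (d ∷ cs) t) ⟩
    next (next (c ∷ actσ _∙_ (d ∷ cs) t))             ≡⟨ cong next (actσ-cons _∙_ c _ t) ⟩
    next (c ∷ actσ _∙_ (actσ _∙_ (d ∷ cs) t) t)       ≡⟨ actσ-cons _∙_ c _ t ⟩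
    c ∷ actσ _∙_ (actσ _∙_ (actσ _∙_ (d ∷ cs) t) t) t ≡⟨ cong (c ∷_) (actσ³-fixed (d ∷ cs) t e₁ e₂) ⟩
    c ∷ d ∷ cs                                        ∎
    where
    open ≡-Reasoning
    next : Vec A _ → Vec A _
    next v = actσ _∙_ v (suc t)

  actσ⁻¹-actσ : (_◁_ : A → A → A) (s : Vec A (suc k)) (t : Fin k) →
    (lookup s (inject₁ t) ∙ lookup s (suc t)) ◁ lookup s (suc t) ≡ lookup s (inject₁ t) →
    actσ⁻¹ _◁_ (actσ _∙_ s t) t ≡ s
  actσ⁻¹-actσ _◁_ (c ∷ d ∷ cs) zero    e = cong (λ a → a ∷ d ∷ cs) e
  actσ⁻¹-actσ _◁_ (c ∷ d ∷ cs) (suc t) e = begin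
    actσ⁻¹ _◁_ (actσ _∙_ (c ∷ d ∷ cs) (suc t)) (suc t) ≡⟨ cong (λ v → actσ⁻¹ _◁_ v (suc t)) (actσ-cons _∙_ c (d ∷ cs) t) ⟩
    actσ⁻¹ _◁_ (c ∷ actσ _∙_ (d ∷ cs) t) (suc t)       ≡⟨ actσ⁻¹-cons _◁_ c _ t ⟩
    c ∷ actσ⁻¹ _◁_ (actσ _∙_ (d ∷ cs) t) t             ≡⟨ cong (c ∷_) (actσ⁻¹-actσ _◁_ (d ∷ cs) t e) ⟩
    c ∷ d ∷ cs                                          ∎
    where open ≡-Reasoning

act-++ : ∀ {m} (s : Vec (Transp m) (suc k)) (w₁ w₂ : BraidWord k) → act s (w₁ ++ w₂) ≡ act (act s w₁) w₂
act-++ s []       w₂ = refl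
act-++ s (l ∷ w₁) w₂ = act-++ (actLetter s l) w₁ w₂

toSym-++ : (w₁ w₂ : BraidWord k) → toSym (w₁ ++ w₂) ≈ toSym w₁ ∘ₚ toSym w₂
toSym-++ []       w₂ x = refl
toSym-++ (l ∷ w₁) w₂ x = toSym-++ w₁ w₂ (letterPerm l ⟨$⟩ʳ x)

module _ {m : ℕ} where

  record StabLift (s : Vec (Transp m) (suc k)) (π : Permutation′ (suc k)) : Set where
    constructor stabLift
    field
      word       : BraidWord k
      stabilises : act s word ≡ s
      maps-to    : toSym word ≈ π

  stabLift-id : (s : Vec (Transp m) (suc k)) → StabLift s id
  stabLift-id s = stabLift [] refl (λ _ → refl)

  stabLift-resp-≈ : {s : Vec (Transp m) (suc k)} {π ρ : Permutation′ (suc k)} →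
    π ≈ ρ → StabLift s π → StabLift s ρ
  stabLift-resp-≈ π≈ρ (stabLift w fixes w↦π) = stabLift w fixes (λ x → trans (w↦π x) (π≈ρ x))

  stabLift-∘ : {s : Vec (Transp m) (suc k)} {π ρ : Permutation′ (suc k)} →
    StabLift s π → StabLift s ρ → StabLift s (π ∘ₚ ρ)
  stabLift-∘ {s = s} {ρ = ρ} (stabLift w₁ fixes₁ w₁↦π) (stabLift w₂ fixes₂ w₂↦ρ) =
    stabLift (w₁ ++ w₂) fixes (λ x → trans (toSym-++ w₁ w₂ x) (trans (w₂↦ρ _) (cong (ρ ⟨$⟩ʳ_) (w₁↦π x))))
    where
    open ≡-Reasoning
    fixes : act s (w₁ ++ w₂) ≡ s
    fixes = begin
      act s (w₁ ++ w₂)   ≡⟨ act-++ s w₁ w₂ ⟩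
      act (act s w₁) w₂  ≡⟨ cong (λ v → act v w₂) fixes₁ ⟩
      act s w₂           ≡⟨ fixes₂ ⟩
      s                  ∎

  stabLift-conjugate : {s : Vec (Transp m) (suc k)} {π : Permutation′ (suc k)} (t : Fin k) →
    let τ = transpose (inject₁ t) (suc t) in
    StabLift (actσ _▷_ s t) π → StabLift s (τ ∘ₚ π ∘ₚ τ)
  stabLift-conjugate {s = s} t (stabLift w fixes′ w↦π) =
    stabLift (σ t ∷ w ++ σ⁻¹ t ∷ []) fixes
      (λ x → trans (toSym-++ w (σ⁻¹ t ∷ []) (τ ⟨$⟩ʳ x)) (cong (τ ⟨$⟩ʳ_) (w↦π (τ ⟨$⟩ʳ x))))
    where
    open ≡-Reasoning
    τ = transpose (inject₁ t) (suc t)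
    s′ = actσ _▷_ s t
    fixes : act s (σ t ∷ w ++ σ⁻¹ t ∷ []) ≡ s
    fixes = begin
      act s′ (w ++ σ⁻¹ t ∷ [])        ≡⟨ act-++ s′ w (σ⁻¹ t ∷ []) ⟩
      act (act s′ w) (σ⁻¹ t ∷ [])     ≡⟨ cong (λ v → act v (σ⁻¹ t ∷ [])) fixes′ ⟩
      actσ⁻¹ _▷⁻¹_ s′ t                ≡⟨ actσ⁻¹-actσ _▷_ _▷⁻¹_ s t (▷-inverse (lookup s (inject₁ t)) (lookup s (suc t))) ⟩
      s                                ∎

  SwapLift : Vec (Transp m) (suc k) → Fin (suc k) → Fin (suc k) → Set
  SwapLift s i j = StabLift s (transpose i j)

module _ {m : ℕ} {s : Vec (Transp m) (suc k)} where

  swapLift-refl : (i : Fin (suc k)) → SwapLift s i i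
  swapLift-refl i = stabLift-resp-≈ (λ x → sym (transpose-refl i x)) (stabLift-id s)

  swapLift-sym : {i j : Fin (suc k)} → SwapLift s i j → SwapLift s j i
  swapLift-sym {i} {j} = stabLift-resp-≈ (transpose-comm i j)

  swapLift-trans : {a b c : Fin (suc k)} → SwapLift s a b → SwapLift s b c → SwapLift s a c
  swapLift-trans {a} {b} {c} ab bc with c ≟ a | c ≟ b
  ... | yes refl | _        = swapLift-refl c
  ... | no _     | yes refl = ab
  ... | no c≢a   | no c≢b   =
    swapLift-sym (stabLift-resp-≈ (transpose-conjugate c≢a c≢b)
      (stabLift-∘ (swapLift-sym ab) (stabLift-∘ (swapLift-sym bc) (swapLift-sym ab))))

swapLift-adjacent : ∀ {m} (s : Vec (Transp m) (suc k)) (t : Fin k) →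
  Meets (lookup s (inject₁ t)) (lookup s (suc t)) → SwapLift s (inject₁ t) (suc t)
swapLift-adjacent s t meet with meets-cases meet
... | inj₁ x≡y =
  stabLift (σ t ∷ []) (actσ-fixed _▷_ s t x≡y (trans (cong (_▷ y) x≡y) (▷-idem y))) (λ _ → refl)
  where y = lookup s (suc t)
... | inj₂ once =
  stabLift (σ t ∷ σ t ∷ σ t ∷ [])
    (actσ³-fixed _▷_ s t (▷-braidˡ once) (trans (cong ((x ▷ y) ▷_) (▷-braidˡ once)) (▷-braidʳ once)))
    (λ i → transpose-involutive (inject₁ t) (suc t) (transpose (inject₁ t) (suc t) ⟨$⟩ʳ i))
  where
  x = lookup s (inject₁ t)
  y = lookup s (suc t)

swapLift-slide : ∀ {m} {s : Vec (Transp m) (suc k)} {i : Fin (suc k)} (t : Fin k) →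
  i ≢ inject₁ t → i ≢ suc t → SwapLift (actσ _▷_ s t) i (inject₁ t) → SwapLift s i (suc t)
swapLift-slide t i≢t i≢t+1 = stabLift-resp-≈ (transpose-conjugate i≢t+1 i≢t) ∘ stabLift-conjugate t

swapLift-upward : ∀ {m} (i : Fin (suc k)) {j : Fin (suc k)} → i Fin.≤ j →
  (s : Vec (Transp m) (suc k)) → Meets (lookup s i) (lookup s j) → SwapLift s i j
swapLift-upward {m = m} i = <-weakInduction-startingFrom P (λ s _ → swapLift-refl i) step
  where
  P : Fin _ → Set
  P j = (s : Vec (Transp m) _) → Meets (lookup s i) (lookup s j) → SwapLift s i j
  step : ∀ t → P (inject₁ t) → P (suc t)
  step t ih s meet with i ≟ suc t | i ≟ inject₁ t
  ... | yes refl | _        = swapLift-refl i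
  ... | no _     | yes refl = swapLift-adjacent s t meet
  ... | no i≢t+1 | no i≢t   = swapLift-slide t i≢t i≢t+1 (ih (actσ _▷_ s t)
    (subst₂ Meets (sym (lookup-actσ-other _▷_ s t i≢t i≢t+1)) (sym (lookup-actσ-inject₁ _▷_ s t)) meet))

swapLift-meets : ∀ {m} (s : Vec (Transp m) (suc k)) (i j : Fin (suc k)) →
  Meets (lookup s i) (lookup s j) → SwapLift s i j
swapLift-meets s i j meet with ≤-total i j
... | inj₁ i≤j = swapLift-upward i i≤j s meet
... | inj₂ j≤i = swapLift-sym (swapLift-upward j j≤i s (Product.map₂ Product.swap meet))

module _ {m : ℕ} (s : Vec (Transp m) (suc k)) where

  Reached : Fin m → Set
  Reached z = Σ[ j ∈ Fin (suc k) ] SwapLift s zero j × z ∈ₜ lookup s j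

  ReachClosed : Transp m → Set
  ReachClosed x = ∀ {u v} → u ∈ₜ x → v ∈ₜ x → Reached u → Reached v

  reached-image : (y : Transp m) → ReachClosed y → {z : Fin m} → Reached z → Reached (toPerm y ⟨$⟩ʳ z)
  reached-image ((c , d) , _) closed {z} reached = cases (z ≟ c) (z ≟ d)
    where
    cases : Dec (z ≡ c) → Dec (z ≡ d) → Reached (transpose c d ⟨$⟩ʳ z)
    cases (yes refl) _          = subst Reached (sym (transpose-applyˡ z d)) (closed (inj₁ refl) (inj₂ refl) reached)
    cases (no _)     (yes refl) = subst Reached (sym (transpose-applyʳ c z)) (closed (inj₂ refl) (inj₁ refl) reached)
    cases (no z≢c)   (no z≢d)   = subst Reached (sym (transpose-fix c d z≢c z≢d)) reached

  reached-preimage : (y : Transp m) → ReachClosed y → {z : Fin m} → Reached (toPerm y ⟨$⟩ʳ z) → Reached z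
  reached-preimage y@((c , d) , _) closed {z} reached =
    subst Reached (transpose-involutive c d z) (reached-image y closed reached)

  reachClosed-▷ : (x y : Transp m) → ReachClosed x → ReachClosed y → ReachClosed (x ▷ y)
  reachClosed-▷ x y x-closed y-closed u∈x▷y v∈x▷y reached with ∈ₜ-▷⁻ x y u∈x▷y | ∈ₜ-▷⁻ x y v∈x▷y
  ... | u , u∈x , refl | v , v∈x , refl =
    reached-image y y-closed (x-closed u∈x v∈x (reached-preimage y y-closed reached))

  reachClosed-lookup : (j : Fin (suc k)) → ReachClosed (lookup s j)
  reachClosed-lookup j u∈j v∈j (i , 0~i , u∈i) =
    j , swapLift-trans 0~i (swapLift-meets s i j (_ , u∈i , u∈j)) , v∈j

  module _ (generates : Generates s) where

    reached-all : (z : Fin m) → Reached z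
    reached-all z = cases (z ≟ a)
      where
      a = proj₁ (proj₁ (lookup s zero))
      a-reached : Reached a
      a-reached = zero , swapLift-refl zero , inj₁ refl
      cases : Dec (z ≡ a) → Reached z
      cases (yes refl) = a-reached
      cases (no z≢a)   = generates ReachClosed reachClosed-▷ reachClosed-lookup (mkTransp a z a≢z)
        (Equivalence.from (∈ₜ-mkTransp a≢z) (inj₁ refl)) (Equivalence.from (∈ₜ-mkTransp a≢z) (inj₂ refl))
        a-reached
        where a≢z = ≢-sym z≢a

    swapLift-zero : (j : Fin (suc k)) → SwapLift s zero j
    swapLift-zero j with reached-all (proj₁ (proj₁ (lookup s j)))
    ... | i , 0~i , a∈i = swapLift-trans 0~i (swapLift-meets s i j (_ , a∈i , inj₁ refl))

    swapLift-all : (i j : Fin (suc k)) → SwapLift s i j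
    swapLift-all i j = swapLift-trans (swapLift-sym (swapLift-zero i)) (swapLift-zero j)

stabLift-from-swaps : ∀ {m} {s : Vec (Transp m) (suc k)} → (∀ i j → SwapLift s i j) →
  (π : Permutation′ (suc k)) → StabLift s π
stabLift-from-swaps {s = s} swaps π = stabLift-resp-≈ (eval-decompose π) (lift-eval (decompose π))
  where
  lift-eval : (xs : TranspositionList _) → StabLift s (eval xs)
  lift-eval []             = stabLift-id s
  lift-eval ((i , j) ∷ xs) = stabLift-∘ (swaps i j) (lift-eval xs)

mainTheorem18 : (m : ℕ) → 2 ≤ m → (k : ℕ) → (s : Vec (Transp m) (suc k)) →
    Generates s →
    (π : Permutation′ (suc k)) →
    Σ (BraidWord k) (λ w → (act s w ≡ s) × ((i : Fin (suc k)) → toSym w ⟨$⟩ʳ i ≡ π ⟨$⟩ʳ i))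
mainTheorem18 _ _ _ s generates π = word , stabilises , maps-to
  where open StabLift (stabLift-from-swaps (swapLift-all s generates) π)
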